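{- Let $(L,\vee,\wedge,0,1)$ be a complemented modular lattice, $a\in L$ and $A$ a non-empty subset of $L$. Then $(a^+,\le)$, $(A^+,\le)$ and $(a^{++},\le)$ are antichains.
   Context: A bounded lattice is complemented if every element $a$ has some $b$ with $a\vee b=1$, $a\wedge b=0$ (complements need not be unique); lattices are non-trivial. For $A\subseteq L$, $A^+:=\{x\in L\mid a\vee x=1\text{ and }a\wedge x=0\text{ for all }a\in A\}$; $a^+:=\{a\}^+$ and $a^{++}:=(a^+)^+$. -}

module Defs where

open import Level using (Level; _⊔_; suc)
open import Data.Product using (Σ; _×_; ∃)
open import Relation.Nullary using (¬_)
open import Relation.Unary using (Pred; _∈_)
open import Relation.Binary.Lattice using (BoundedLattice)

module _ {c ℓ₁ ℓ₂ : Level} (L : BoundedLattice c ℓ₁ ℓ₂) where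
  open BoundedLattice L

  IsModular : Set (c ⊔ ℓ₁ ⊔ ℓ₂)
  IsModular = ∀ x y z → x ≤ z → (x ∨ (y ∧ z)) ≈ ((x ∨ y) ∧ z)

  IsComplementOf : Carrier → Carrier → Set ℓ₁
  IsComplementOf a b = ((a ∨ b) ≈ ⊤) × ((a ∧ b) ≈ ⊥)

  IsComplemented : Set (c ⊔ ℓ₁)
  IsComplemented = ∀ a → Σ Carrier (λ b → IsComplementOf a b)

  IsNonTrivial : Set ℓ₁
  IsNonTrivial = ¬ (⊥ ≈ ⊤)

  _⁺ : {ℓ : Level} → Pred Carrier ℓ → Pred Carrier (c ⊔ ℓ ⊔ ℓ₁)
  (A ⁺) x = ∀ a → a ∈ A → IsComplementOf a x

  ｛_｝ : Carrier → Pred Carrier ℓ₁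
  ｛ a ｝ x = x ≈ a

  _⁺¹ : Carrier → Pred Carrier (c ⊔ ℓ₁)
  a ⁺¹ = ｛ a ｝ ⁺

  _⁺⁺ : Carrier → Pred Carrier (c ⊔ ℓ₁)
  a ⁺⁺ = (a ⁺¹) ⁺

  IsAntichain : {ℓ : Level} → Pred Carrier ℓ → Set (c ⊔ ℓ ⊔ ℓ₁ ⊔ ℓ₂)
  IsAntichain S = ∀ x y → x ∈ S → y ∈ S → x ≤ y → x ≈ y

  NonEmpty : {ℓ : Level} → Pred Carrier ℓ → Set (c ⊔ ℓ)
  NonEmpty A = ∃ λ x → x ∈ A

module Submission where

-- Complements of a fixed element b in a modular lattice form an antichain:
-- if x ≤ y are both complements of b, then modularity gives
-- y = (x ∨ b) ∧ y = x ∨ (b ∧ y) = x ∨ 0 = x.  Each of a⁺, A⁺ and a⁺⁺ is an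
-- intersection of such sets of complements, and it is a non-empty
-- intersection: A ≠ ∅ by hypothesis, and a⁺ ≠ ∅ since L is complemented.

open import Defs
open import Level using (Level)
open import Data.Product using (_×_; _,_)
open import Relation.Unary using (Pred)
open import Relation.Binary.Lattice using (BoundedLattice)
import Relation.Binary.Lattice.Properties.JoinSemilattice as JoinSemilatticeProperties
import Relation.Binary.Lattice.Properties.MeetSemilattice as MeetSemilatticeProperties
import Relation.Binary.Reasoning.PartialOrder as ≤-Reasoning

module _ {c ℓ₁ ℓ₂ : Level} (L : BoundedLattice c ℓ₁ ℓ₂) where
  open BoundedLattice L
  open JoinSemilatticeProperties joinSemilattice using (∨-cong; ∨-comm)
  open MeetSemilatticeProperties meetSemilattice using (∧-cong)

  IsComplementOf-respˡ : ∀ {a a′ b} → a ≈ a′ → IsComplementOf L a b → IsComplementOf L a′ b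
  IsComplementOf-respˡ a≈a′ (a∨b≈⊤ , a∧b≈⊥) =
      Eq.trans (∨-cong (Eq.sym a≈a′) Eq.refl) a∨b≈⊤
    , Eq.trans (∧-cong (Eq.sym a≈a′) Eq.refl) a∧b≈⊥

  ｛｝-nonEmpty : ∀ a → NonEmpty L (｛_｝ L a)
  ｛｝-nonEmpty a = a , Eq.refl

  ⁺¹-nonEmpty : IsComplemented L → ∀ a → NonEmpty L (_⁺¹ L a)
  ⁺¹-nonEmpty complemented a with complemented a
  ... | b , b-complement =
    b , λ a′ a′≈a → IsComplementOf-respˡ (Eq.sym a′≈a) b-complement

  module _ (modular : IsModular L) where
    open ≤-Reasoning poset

    complements-antichain : ∀ b → IsAntichain L (IsComplementOf L b)
    complements-antichain b x y (b∨x≈⊤ , _) (_ , b∧y≈⊥) x≤y = antisym x≤y y≤x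
      where
      y≤x∨b : y ≤ x ∨ b
      y≤x∨b = begin
        y      ≤⟨ maximum y ⟩
        ⊤      ≈⟨ Eq.sym b∨x≈⊤ ⟩
        b ∨ x  ≈⟨ ∨-comm b x ⟩
        x ∨ b  ∎

      y≤x : y ≤ x
      y≤x = begin
        y                ≤⟨ ∧-greatest y≤x∨b refl ⟩
        (x ∨ b) ∧ y      ≈⟨ Eq.sym (modular x b y x≤y) ⟩
        x ∨ (b ∧ y)      ≤⟨ ∨-least refl (trans (reflexive b∧y≈⊥) (minimum x)) ⟩
        x                ∎

    ⁺-antichain : ∀ {ℓ} {A : Pred Carrier ℓ} → NonEmpty L A → IsAntichain L (_⁺ L A)
    ⁺-antichain (a , a∈A) x y x∈A⁺ y∈A⁺ =
      complements-antichain a x y (x∈A⁺ a a∈A) (y∈A⁺ a a∈A)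

corollary2p4 : {c ℓ₁ ℓ₂ ℓ : Level} (L : BoundedLattice c ℓ₁ ℓ₂)
    → IsNonTrivial L → IsComplemented L → IsModular L
    → (a : BoundedLattice.Carrier L)
    → (A : Pred (BoundedLattice.Carrier L) ℓ) → NonEmpty L A
    → IsAntichain L (_⁺¹ L a) × IsAntichain L (_⁺ L A) × IsAntichain L (_⁺⁺ L a)
corollary2p4 L _ complemented modular a A A≠∅ =
    ⁺-antichain L modular (｛｝-nonEmpty L a)
  , ⁺-antichain L modular A≠∅
  , ⁺-antichain L modular (⁺¹-nonEmpty L complemented a)
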